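{- Let $k$ be a prime power, and let $P_k$ be the graph constructed from a finite projective plane of order $k$ with an arbitrary strict linear order $<$ on its points, as described in the context. Then $P_k$ contains no triangles, $\alpha(P_k) \leq 2(k^2 + k + 1)$, and $\chi(P_k) \geq \frac{k + 1}{2}$.
   Context: A finite projective plane of order $k$ has $k^2+k+1$ points and $k^2+k+1$ lines, each line containing $k+1$ points, and any two distinct points lie on exactly one common line. The graph $P_k$: fix such a plane and any strict linear order $<$ on its points; the vertices are all incidence pairs $(p, L)$ with $p$ a point on line $L$; vertices $(p, L)$ and $(p', L')$ are adjacent iff $p < p'$, $L \neq L'$, and $p \in L'$. $\alpha$ is the independence number and $\chi$ the chromatic number. -}

module Defs where

open import Level using (0ℓ)
open import Data.Nat using (ℕ; suc; _+_; _*_; _^_; _≤_)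
open import Data.Nat.Primality using (Prime)
open import Data.Fin using (Fin)
open import Data.Fin.Subset using (Subset; _∈_; ∣_∣)
open import Data.Product using (Σ; Σ-syntax; ∃; ∃-syntax; _×_; _,_)
open import Data.Sum using (_⊎_)
open import Data.List using (List; length)
open import Data.List.Membership.Propositional renaming (_∈_ to _∈ₗ_)
open import Data.List.Relation.Unary.Unique.Propositional using (Unique)
open import Relation.Nullary using (¬_)
open import Relation.Binary using (Rel; IsStrictTotalOrder)
open import Relation.Binary.PropositionalEquality using (_≡_; _≢_)

IsPrimePower : ℕ → Set
IsPrimePower k = Σ[ p ∈ ℕ ] Σ[ e ∈ ℕ ] (Prime p × 1 ≤ e × k ≡ p ^ e)

N : ℕ → Set
N k = Fin (k * k + k + 1)

-- A finite projective plane of order k: points and lines are both indexed by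
-- Fin (k²+k+1); each line is given as the subset of points lying on it.
record ProjectivePlane (k : ℕ) : Set where
  field
    line : N k → Subset (k * k + k + 1)
    lineSize : ∀ L → ∣ line L ∣ ≡ k + 1
    joinLine : ∀ p q → p ≢ q →
      Σ[ L ∈ N k ] ((p ∈ line L × q ∈ line L) ×
        (∀ L' → p ∈ line L' → q ∈ line L' → L' ≡ L))

module _ {k : ℕ} (Π : ProjectivePlane k) (_<_ : Rel (N k) 0ℓ) where
  open ProjectivePlane Π

  Vertex : Set
  Vertex = N k × N k

  IsVertex : Vertex → Set
  IsVertex (p , L) = p ∈ line L

  Arc : Vertex → Vertex → Set
  Arc (p , L) (p' , L') = (p < p') × (L ≢ L') × (p ∈ line L')

  Adj : Vertex → Vertex → Set
  Adj u v = Arc u v ⊎ Arc v u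

  TriangleFree : Set
  TriangleFree = ¬ (Σ[ u ∈ Vertex ] Σ[ v ∈ Vertex ] Σ[ w ∈ Vertex ]
    (IsVertex u × IsVertex v × IsVertex w × Adj u v × Adj v w × Adj u w))

  IsIndependent : List Vertex → Set
  IsIndependent S = Unique S × (∀ {u} → u ∈ₗ S → IsVertex u) ×
    (∀ {u v} → u ∈ₗ S → v ∈ₗ S → ¬ Adj u v)

  IndependenceNumberAtMost : ℕ → Set
  IndependenceNumberAtMost b = ∀ (S : List Vertex) → IsIndependent S → length S ≤ b

  -- proper colouring of P_k with m colours (values on non-vertices are irrelevant)
  IsProperColouring : (m : ℕ) → (Vertex → Fin m) → Set
  IsProperColouring m c = ∀ u v → IsVertex u → IsVertex v → Adj u v → c u ≢ c v

  -- χ(P_k) ≥ (k+1)/2, i.e. every proper m-colouring has 2m ≥ k+1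
  ChromaticAtLeastHalfSucK : Set
  ChromaticAtLeastHalfSucK = ∀ m (c : Vertex → Fin m) → IsProperColouring m c → k + 1 ≤ 2 * m

{-# OPTIONS --safe #-}
module Submission where

-- A triangle of P_k is oriented either cyclically, which the transitivity of < forbids, or
-- transitively as a → b → c with a → c. In the latter case the distinct points of a and b
-- both lie on the line of b and on the line of c, so these lines coincide, contradicting b → c.
--
-- Inside one colour class (an independent set), call (p, L) dominated if the class contains
-- some (p', L) with p < p'. Undominated vertices have pairwise distinct lines (compare their
-- points), and dominated ones have pairwise distinct points: if (p, L) is dominated by
-- (p', L) and (p, L') is in the class with L' ≠ L, then (p, L') → (p', L). So a colour class
-- has at most 2(k²+k+1) vertices, while P_k has (k²+k+1)(k+1) of them.

open import Defs
open import Level using (0ℓ)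
open import Data.Nat using (ℕ; _+_; _*_; _≤_; >-nonZero)
open import Data.Nat.Properties
  using (≤-trans; ≤-reflexive; +-assoc; m≤n+m; *-cancelˡ-≤; module ≤-Reasoning)
open import Data.Nat.Solver using (module +-*-Solver)
open import Data.Product using (_×_; ∃; _,_; proj₁; proj₂)
open import Data.Sum using (_⊎_; inj₁; inj₂)
open import Data.Sum.Properties using (inj₁-injective; inj₂-injective)
open import Data.Empty using (⊥-elim)
open import Data.Fin using (Fin; zero; suc; _≟_; cast; combine; join; splitAt; remQuot)
open import Data.Fin.Properties
  using (suc-injective; cast-involutive; combine-injective; splitAt-join; injective⇒≤; *↔×; any?)
open import Data.Fin.Subset using (Subset; _∈_; ∣_∣; inside; outside)
open import Data.Vec using (_∷_; here; there)
open import Data.List using (List; lookup)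
open import Data.List.Relation.Unary.All as All using ()
open import Data.List.Relation.Unary.AllPairs using (_∷_)
open import Data.List.Relation.Unary.Unique.Propositional using (Unique)
open import Data.List.Membership.Propositional.Properties using (∈-lookup)
open import Function using (Injective; Injection; _∘_)
open import Function.Properties.Inverse using (↔⇒↣)
open import Relation.Binary using (Rel; IsStrictTotalOrder; tri<; tri≈; tri>)
open import Relation.Binary.PropositionalEquality
  using (_≡_; _≢_; refl; sym; trans; cong; cong₂; subst; subst₂; module ≡-Reasoning)
open import Relation.Nullary using (¬_; Dec; yes; no)
open import Relation.Nullary.Decidable using (_×-dec_)

lookup-injective : ∀ {A : Set} {xs : List A} → Unique xs → Injective _≡_ _≡_ (lookup xs)
lookup-injective (_ ∷ _) {zero} {zero} _ = refl
lookup-injective (x∉xs ∷ _) {zero} {suc j} x≡xsⱼ = ⊥-elim (All.lookup x∉xs (∈-lookup j) x≡xsⱼ)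
lookup-injective (x∉xs ∷ _) {suc i} {zero} xsᵢ≡x = ⊥-elim (All.lookup x∉xs (∈-lookup i) (sym xsᵢ≡x))
lookup-injective (_ ∷ u) {suc i} {suc j} eq = cong suc (lookup-injective u eq)

enumerate : ∀ {n} (p : Subset n) → Fin ∣ p ∣ → Fin n
enumerate (inside ∷ p) zero = zero
enumerate (inside ∷ p) (suc i) = suc (enumerate p i)
enumerate (outside ∷ p) i = suc (enumerate p i)

enumerate-∈ : ∀ {n} (p : Subset n) i → enumerate p i ∈ p
enumerate-∈ (inside ∷ p) zero = here
enumerate-∈ (inside ∷ p) (suc i) = there (enumerate-∈ p i)
enumerate-∈ (outside ∷ p) i = there (enumerate-∈ p i)

enumerate-injective : ∀ {n} (p : Subset n) → Injective _≡_ _≡_ (enumerate p)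
enumerate-injective (inside ∷ p) {zero} {zero} _ = refl
enumerate-injective (inside ∷ p) {suc i} {suc j} eq = cong suc (enumerate-injective p (suc-injective eq))
enumerate-injective (outside ∷ p) eq = enumerate-injective p (suc-injective eq)

cast-injective : ∀ {m n} .(m≡n : m ≡ n) → Injective _≡_ _≡_ (cast m≡n)
cast-injective m≡n {i} {j} eq = begin
  i                           ≡⟨ sym (cast-involutive (sym m≡n) m≡n i) ⟩
  cast (sym m≡n) (cast m≡n i) ≡⟨ cong (cast (sym m≡n)) eq ⟩
  cast (sym m≡n) (cast m≡n j) ≡⟨ cast-involutive (sym m≡n) m≡n j ⟩
  j                           ∎
  where open ≡-Reasoning

≤-by-injection-into-×⊎ : ∀ {n m a b} {f : Fin n → Fin m × (Fin a ⊎ Fin b)} →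
  Injective _≡_ _≡_ f → n ≤ m * (a + b)
≤-by-injection-into-×⊎ {a = a} {b} f-injective = injective⇒≤ (f-injective ∘ encode-injective)
  where
  encode : ∀ {m} → Fin m × (Fin a ⊎ Fin b) → Fin (m * (a + b))
  encode (i , t) = combine i (join a b t)
  encode-injective : ∀ {m} → Injective _≡_ _≡_ (encode {m})
  encode-injective {x = i , t} {i′ , t′} eq with refl , join-eq ← combine-injective i _ i′ _ eq =
    cong (i ,_) (trans (sym (splitAt-join a b t)) (trans (cong (splitAt a) join-eq) (splitAt-join a b t′)))

module _ {k : ℕ} (Π : ProjectivePlane k) where
  open ProjectivePlane Π

  joinLine-unique : ∀ {p q L L′} → p ≢ q → p ∈ line L → q ∈ line L →
    p ∈ line L′ → q ∈ line L′ → L ≡ L′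
  joinLine-unique p≢q p∈L q∈L p∈L′ q∈L′ =
    let (_ , _ , unique) = joinLine _ _ p≢q in trans (unique _ p∈L q∈L) (sym (unique _ p∈L′ q∈L′))

module _ {k : ℕ} (Π : ProjectivePlane k) {_<_ : Rel (N k) 0ℓ} (<-sto : IsStrictTotalOrder _≡_ _<_) where
  open ProjectivePlane Π
  open IsStrictTotalOrder <-sto using (compare; _<?_) renaming (trans to <-trans; irrefl to <-irrefl)

  arc-intransitive : ∀ {a b c} → IsVertex Π _<_ b →
    Arc Π _<_ a b → Arc Π _<_ b c → ¬ Arc Π _<_ a c
  arc-intransitive pb∈Lb (pa<pb , _ , pa∈Lb) (_ , Lb≢Lc , pb∈Lc) (_ , _ , pa∈Lc) =
    Lb≢Lc (joinLine-unique Π (λ pa≡pb → <-irrefl pa≡pb pa<pb) pa∈Lb pb∈Lb pa∈Lc pb∈Lc)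

  arc-acyclic₃ : ∀ {a b c} → Arc Π _<_ a b → Arc Π _<_ b c → ¬ Arc Π _<_ c a
  arc-acyclic₃ (pa<pb , _) (pb<pc , _) (pc<pa , _) = <-irrefl refl (<-trans (<-trans pa<pb pb<pc) pc<pa)

  triangleFree : TriangleFree Π _<_
  triangleFree (_ , _ , _ , a∈ , b∈ , c∈ , inj₁ ab , inj₁ bc , inj₁ ac) = arc-intransitive b∈ ab bc ac
  triangleFree (_ , _ , _ , a∈ , b∈ , c∈ , inj₁ ab , inj₁ bc , inj₂ ca) = arc-acyclic₃ ab bc ca
  triangleFree (_ , _ , _ , a∈ , b∈ , c∈ , inj₁ ab , inj₂ cb , inj₁ ac) = arc-intransitive c∈ ac cb ab
  triangleFree (_ , _ , _ , a∈ , b∈ , c∈ , inj₁ ab , inj₂ cb , inj₂ ca) = arc-intransitive a∈ ca ab cb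
  triangleFree (_ , _ , _ , a∈ , b∈ , c∈ , inj₂ ba , inj₁ bc , inj₁ ac) = arc-intransitive a∈ ba ac bc
  triangleFree (_ , _ , _ , a∈ , b∈ , c∈ , inj₂ ba , inj₁ bc , inj₂ ca) = arc-intransitive c∈ bc ca ba
  triangleFree (_ , _ , _ , a∈ , b∈ , c∈ , inj₂ ba , inj₂ cb , inj₁ ac) = arc-acyclic₃ ac cb ba
  triangleFree (_ , _ , _ , a∈ , b∈ , c∈ , inj₂ ba , inj₂ cb , inj₂ ca) = arc-intransitive b∈ cb ba ca

  v : ℕ
  v = k * k + k + 1

  module ColouredFamily {n m} (e : Fin n → Vertex Π _<_) (e-injective : Injective _≡_ _≡_ e)
    (e-incident : ∀ i → IsVertex Π _<_ (e i)) (c : Fin n → Fin m)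
    (c-proper : ∀ i j → c i ≡ c j → ¬ Arc Π _<_ (e i) (e j)) where

    pt ln : Fin n → N k
    pt = proj₁ ∘ e
    ln = proj₂ ∘ e

    Dominates : Fin n → Fin n → Set
    Dominates j i = ln j ≡ ln i × c j ≡ c i × pt i < pt j

    Dominated : Fin n → Set
    Dominated i = ∃ λ j → Dominates j i

    dominated? : ∀ i → Dec (Dominated i)
    dominated? i = any? λ j → (ln j ≟ ln i) ×-dec (c j ≟ c i) ×-dec (pt i <? pt j)

    ≡-from-pt-ln : ∀ {i j} → pt i ≡ pt j → ln i ≡ ln j → i ≡ j
    ≡-from-pt-ln pt-eq ln-eq = e-injective (cong₂ _,_ pt-eq ln-eq)

    dominated-unique : ∀ {i j} → Dominated i → c i ≡ c j → pt i ≡ pt j → i ≡ j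
    dominated-unique {i} {j} (d , ln-eq , c-eq , pti<ptd) ci≡cj pti≡ptj with ln i ≟ ln j
    ... | yes lni≡lnj = ≡-from-pt-ln pti≡ptj lni≡lnj
    ... | no lni≢lnj = ⊥-elim (c-proper j d (trans (sym ci≡cj) (sym c-eq)) arc)
      where
      arc : Arc Π _<_ (e j) (e d)
      arc = subst (_< pt d) pti≡ptj pti<ptd
          , (λ lnj≡lnd → lni≢lnj (trans (sym ln-eq) (sym lnj≡lnd)))
          , subst₂ (λ p L → p ∈ line L) pti≡ptj (sym ln-eq) (e-incident i)

    undominated-unique : ∀ {i j} → ¬ Dominated i → ¬ Dominated j → c i ≡ c j → ln i ≡ ln j → i ≡ j
    undominated-unique {i} {j} ¬di ¬dj ci≡cj lni≡lnj with compare (pt i) (pt j)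
    ... | tri< pti<ptj _ _ = ⊥-elim (¬di (j , sym lni≡lnj , sym ci≡cj , pti<ptj))
    ... | tri≈ _ pti≡ptj _ = ≡-from-pt-ln pti≡ptj lni≡lnj
    ... | tri> _ _ ptj<pti = ⊥-elim (¬dj (i , lni≡lnj , ci≡cj , ptj<pti))

    tag : ∀ i → Dec (Dominated i) → N k ⊎ N k
    tag i (yes _) = inj₂ (pt i)
    tag i (no _) = inj₁ (ln i)

    tag-injective : ∀ {i j} (di : Dec (Dominated i)) (dj : Dec (Dominated j)) →
      c i ≡ c j → tag i di ≡ tag j dj → i ≡ j
    tag-injective (yes di) (yes _) ci≡cj eq = dominated-unique di ci≡cj (inj₂-injective eq)
    tag-injective (yes _) (no _) _ ()
    tag-injective (no _) (yes _) _ ()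
    tag-injective (no ¬di) (no ¬dj) ci≡cj eq = undominated-unique ¬di ¬dj ci≡cj (inj₁-injective eq)

    label : Fin n → Fin m × (N k ⊎ N k)
    label i = c i , tag i (dominated? i)

    label-injective : Injective _≡_ _≡_ label
    label-injective {i} {j} eq =
      tag-injective (dominated? i) (dominated? j) (cong proj₁ eq) (cong proj₂ eq)

    size≤ : n ≤ m * (v + v)
    size≤ = ≤-by-injection-into-×⊎ label-injective

  independenceNumber≤ : IndependenceNumberAtMost Π _<_ (2 * v)
  independenceNumber≤ S (S-unique , S-incident , S-independent) =
    ≤-trans (ColouredFamily.size≤ {m = 1} (lookup S) (lookup-injective S-unique)
               (S-incident ∘ ∈-lookup) (λ _ → zero)
               (λ i j _ arc → S-independent (∈-lookup i) (∈-lookup j) (inj₁ arc)))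
            (≤-reflexive (+-assoc v v 0))

  incidence : N k × Fin (k + 1) → Vertex Π _<_
  incidence (L , j) = enumerate (line L) (cast (sym (lineSize L)) j) , L

  incidence-injective : Injective _≡_ _≡_ incidence
  incidence-injective {L , i} {L′ , j} eq with refl ← cong proj₂ eq =
    cong (L ,_) (cast-injective (sym (lineSize L)) (enumerate-injective (line L) (cong proj₁ eq)))

  vertexAt : Fin (v * (k + 1)) → Vertex Π _<_
  vertexAt = incidence ∘ remQuot (k + 1)

  vertexAt-injective : Injective _≡_ _≡_ vertexAt
  vertexAt-injective = Injection.injective (↔⇒↣ (*↔× {v})) ∘ incidence-injective

  vertexAt-incident : ∀ i → IsVertex Π _<_ (vertexAt i)
  vertexAt-incident i =
    let (L , j) = remQuot (k + 1) i in enumerate-∈ (line L) (cast (sym (lineSize L)) j)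

  chromaticNumber≥ : ChromaticAtLeastHalfSucK Π _<_
  chromaticNumber≥ m c c-proper = *-cancelˡ-≤ v {{>-nonZero (m≤n+m 1 (k * k + k))}} (begin
    v * (k + 1) ≤⟨ ColouredFamily.size≤ vertexAt vertexAt-injective vertexAt-incident (c ∘ vertexAt)
                     (λ i j ci≡cj arc →
                        c-proper _ _ (vertexAt-incident i) (vertexAt-incident j) (inj₁ arc) ci≡cj) ⟩
    m * (v + v) ≡⟨ solve 2 (λ V M → M :* (V :+ V) := V :* (con 2 :* M)) refl v m ⟩
    v * (2 * m) ∎)
    where
    open ≤-Reasoning
    open +-*-Solver

theorem3p2 : (k : ℕ) → IsPrimePower k → (Π : ProjectivePlane k) →
    (_<_ : Rel (N k) 0ℓ) → IsStrictTotalOrder _≡_ _<_ →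
    TriangleFree Π _<_ ×
    IndependenceNumberAtMost Π _<_ (2 * (k * k + k + 1)) ×
    ChromaticAtLeastHalfSucK Π _<_
theorem3p2 k _ Π _<_ <-sto = triangleFree Π <-sto , independenceNumber≤ Π <-sto , chromaticNumber≥ Π <-sto
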